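{- Let $\Gamma$ be a finite $(G,2)$-geodesic-transitive digraph of valency $5$, where $G\leq\mathrm{Aut}(\Gamma)$. Then $\Gamma$ is $(G,2)$-arc-transitive.
   Context: A digraph $\Gamma$ consists of a finite vertex set $V(\Gamma)$ with an antisymmetric irreflexive relation $\rightarrow$; an arc is an ordered pair $(u,v)$ with $u\rightarrow v$; $\Gamma^+(v)=\{w: v\rightarrow w\}$ and the valency is $|\Gamma^+(v)|$. The distance $d_\Gamma(u,v)$ is the length of a shortest directed path from $u$ to $v$. An $s$-arc is a sequence $(v_0,\dots,v_s)$ with $v_i\rightarrow v_{i+1}$ for all $i$; it is an $s$-geodesic if $d_\Gamma(v_0,v_s)=s$. $\Gamma$ is $(G,s)$-geodesic-transitive if $G$ is transitive on the set of $i$-geodesics for each $i\leq s$, and $(G,2)$-arc-transitive if $G$ is transitive on the set of $2$-arcs. -}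

module Defs where

open import Data.Nat using (ℕ; zero; suc; _<_)
open import Data.Fin using (Fin)
open import Data.Bool using (Bool; T; true; false)
open import Data.Unit using (⊤)
open import Data.Empty using (⊥)
open import Data.Product using (_×_; Σ; ∃; ∃-syntax)
open import Data.Vec using (Vec; []; _∷_; head; last; map)
open import Data.List using (length; filterᵇ; allFin)
open import Data.Fin.Permutation using (Permutation′; _⟨$⟩ʳ_; id; flip; _∘ₚ_)
open import Relation.Nullary using (¬_)
open import Relation.Binary.PropositionalEquality using (_≡_)

record Digraph : Set where
  field
    n       : ℕ
    adj     : Fin n → Fin n → Bool
    irrefl  : ∀ u → adj u u ≡ false
    antisym : ∀ u v → T (adj u v) → adj v u ≡ false
open Digraph public

module _ (Γ : Digraph) where
  private
    V = Fin (n Γ)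
    _⇒_ : V → V → Set
    u ⇒ v = T (adj Γ u v)

  outDeg : V → ℕ
  outDeg v = length (filterᵇ (adj Γ v) (allFin (n Γ)))

  data Walk : V → V → ℕ → Set where
    here : ∀ {u} → Walk u u 0
    step : ∀ {u w v k} → u ⇒ w → Walk w v k → Walk u v (suc k)

  Dist : V → V → ℕ → Set
  Dist u v s = Walk u v s × (∀ k → k < s → ¬ Walk u v k)

  -- s-arcs (v₀,…,v_s) as vectors of length s+1
  IsArc : ∀ {s} → Vec V (suc s) → Set
  IsArc (x ∷ [])     = ⊤
  IsArc (x ∷ y ∷ xs) = (x ⇒ y) × IsArc (y ∷ xs)

  IsGeodesic : ∀ {s} → Vec V (suc s) → Set
  IsGeodesic {s} p = IsArc p × Dist (head p) (last p) s

  IsAutomorphism : Permutation′ (n Γ) → Set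
  IsAutomorphism σ = ∀ u v → adj Γ (σ ⟨$⟩ʳ u) (σ ⟨$⟩ʳ v) ≡ adj Γ u v

  record AutSubgroup : Set₁ where
    field
      mem    : Permutation′ (n Γ) → Set
      id∈    : mem id
      comp∈  : ∀ {σ τ} → mem σ → mem τ → mem (σ ∘ₚ τ)
      inv∈   : ∀ {σ} → mem σ → mem (flip σ)
      isAut  : ∀ {σ} → mem σ → IsAutomorphism σ
  open AutSubgroup public

  TransitiveOn : AutSubgroup → ∀ {s} → (Vec V (suc s) → Set) → Set
  TransitiveOn G P = ∀ p q → P p → P q →
    ∃[ σ ] (mem G σ × map (σ ⟨$⟩ʳ_) p ≡ q)

  GeodesicTransitive : AutSubgroup → ℕ → Set
  GeodesicTransitive G s = ∀ i → i Data.Nat.≤ s → TransitiveOn G {i} IsGeodesic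

  ArcTransitive : AutSubgroup → ℕ → Set
  ArcTransitive G s = TransitiveOn G {s} IsArc

module Submission where

-- A 2-arc (x, y, z) has x ≢ z, so it is a 2-geodesic unless x → z; it
-- suffices to exclude such transitive triangles.
--
-- By arc-transitivity the stabiliser G_u induces a vertex-transitive group of
-- automorphisms of the digraph [Γ⁺(u)] on five vertices, which is therefore
-- regular of out- and in-degree k with 2k ≤ 4. If k ≥ 1 it is a directed
-- 5-cycle or a regular tournament, and an automorphism fixing a vertex also
-- fixes the in- and out-neighbours of every fixed vertex. So the fixed and the
-- moved points both form sets closed under out-neighbours, each containing a
-- 2-arc and hence at least three points, which is impossible among five. Thus
-- an element of G fixing u and some v with u → v → w and u → w fixes Γ⁺(u).
--
-- Given a → b → c and a → c, at most two out-neighbours of b lie in Γ⁺(a), so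
-- some σ ∈ G maps a 2-geodesic (a, b, w) to (a, b, w′) with w ≢ w′. Then σ
-- fixes Γ⁺(a) ∋ c, and as (b, c) also lies in a transitive triangle, σ fixes
-- Γ⁺(b) ∋ w, a contradiction.

open import Defs
open import Data.Bool using (Bool; true; false; T; not; _∧_; _∨_)
open import Data.Bool.Properties using (T-∧; T-∨; T-not-≡)
open import Data.Empty using (⊥; ⊥-elim)
open import Data.Fin using (Fin; zero; suc; punchIn; punchOut; inject≤; _≟_)
open import Data.Fin.Permutation using (Permutation′; permutation; _⟨$⟩ʳ_; _⟨$⟩ˡ_; inverseˡ; inverseʳ)
open import Data.Fin.Properties
  using (punchIn-punchOut; punchOut-injective; inject≤-injective; suc-injective; 0≢1+n; nonZeroIndex; injective⇒≤)
open import Data.List using (length; filterᵇ; tabulate)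
open import Data.Nat using (ℕ; zero; suc; _+_; _*_; _≤_; _<_; z≤n; s≤s)
import Data.Nat.Properties as ℕ
open import Data.Nat.Properties
  using ( *-cancelˡ-≡; +-mono-≤; +-monoˡ-≤; +-cancelˡ-≤; ≤-refl; ≤-reflexive; ≤-trans; ≤-pred; ≤-antisym
        ; <-irrefl; 1+n≰n; m≤n+m; m≤n⇒m≤1+n; n≤1+n; module ≤-Reasoning)
open import Algebra.Properties.CommutativeMonoid.Sum ℕ.+-0-commutativeMonoid
  using (sum; sum-remove; sum-cong-≗; sum-permute; ∑-distrib-+; ∑-comm)
open import Data.Product using (Σ; ∃-syntax; ∃₂; _×_; _,_; proj₁; proj₂)
open import Data.Sum using (_⊎_; inj₁; inj₂; [_,_])
open import Data.Unit using (tt)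
open import Data.Vec using ([]; _∷_)
open import Function using (_∘_; id; Equivalence)
open import Function.Bundles using (Injection)
open import Function.Definitions using (Injective)
open import Function.Properties.Inverse using (↔⇒↣)
open import Relation.Binary.PropositionalEquality
  using (_≡_; _≢_; refl; sym; trans; cong; cong₂; subst; module ≡-Reasoning)
open import Relation.Nullary using (¬_)
open import Relation.Nullary.Decidable
  using (yes; no; isYes; toWitness; fromWitness; toWitnessFalse; fromWitnessFalse)

-- Counting subsets of Fin n

iverson : Bool → ℕ
iverson true = 1
iverson false = 0

count : ∀ {n} → (Fin n → Bool) → ℕ
count p = sum (iverson ∘ p)

count-punchIn : ∀ {n} (p : Fin (suc n) → Bool) i → count p ≡ iverson (p i) + count (p ∘ punchIn i)
count-punchIn p i = sum-remove (iverson ∘ p)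

count-cong : ∀ {n} {p q : Fin n → Bool} → (∀ i → p i ≡ q i) → count p ≡ count q
count-cong p≗q = sum-cong-≗ (cong iverson ∘ p≗q)

count≤n : ∀ {n} (p : Fin n → Bool) → count p ≤ n
count≤n {zero} p = z≤n
count≤n {suc n} p with p zero
... | true = s≤s (count≤n (p ∘ suc))
... | false = m≤n⇒m≤1+n (count≤n (p ∘ suc))

count-mono : ∀ {n} (p q : Fin n → Bool) → (∀ i → T (p i) → T (q i)) → count p ≤ count q
count-mono {zero} _ _ _ = z≤n
count-mono {suc n} p q p⊆q with p zero | q zero | p⊆q zero
... | true | true | _ = s≤s (count-mono (p ∘ suc) (q ∘ suc) (p⊆q ∘ suc))
... | true | false | p0⇒q0 = ⊥-elim (p0⇒q0 tt)
... | false | true | _ = m≤n⇒m≤1+n (count-mono (p ∘ suc) (q ∘ suc) (p⊆q ∘ suc))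
... | false | false | _ = count-mono (p ∘ suc) (q ∘ suc) (p⊆q ∘ suc)

count<n : ∀ {n} (p : Fin n → Bool) {i} → ¬ T (p i) → count p < n
count<n {suc n} p {i} ¬pi with p i | count-punchIn p i
... | true | _ = ⊥-elim (¬pi tt)
... | false | eq = s≤s (subst (_≤ n) (sym eq) (count≤n (p ∘ punchIn i)))

count≡n⇒all : ∀ {n} (p : Fin n → Bool) → count p ≡ n → ∀ i → T (p i)
count≡n⇒all p eq i with p i in pi
... | true = tt
... | false = ⊥-elim (<-irrefl eq (count<n p (subst T pi)))

1+count≡n⇒all-but : ∀ {n} (p : Fin n → Bool) {i} → ¬ T (p i) → suc (count p) ≡ n →
                    ∀ {j} → i ≢ j → T (p j)
1+count≡n⇒all-but {suc n} p {i} ¬pi eq {j} i≢j with p i | count-punchIn p i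
... | true | _ = ⊥-elim (¬pi tt)
... | false | split = subst (T ∘ p) (punchIn-punchOut i≢j)
      (count≡n⇒all (p ∘ punchIn i) (trans (sym split) (ℕ.suc-injective eq)) (punchOut i≢j))

1≤count : ∀ {n} (p : Fin n → Bool) {i} → T (p i) → 1 ≤ count p
1≤count {suc n} p {i} pi with p i | count-punchIn p i
... | true | eq = subst (1 ≤_) (sym eq) (s≤s z≤n)

2≤count : ∀ {n} (p : Fin n → Bool) {i j} → i ≢ j → T (p i) → T (p j) → 2 ≤ count p
2≤count {suc n} p {i} {j} i≢j pi pj with p i | count-punchIn p i
... | true | eq = subst (2 ≤_) (sym eq)
      (s≤s (1≤count (p ∘ punchIn i) (subst (T ∘ p) (sym (punchIn-punchOut i≢j)) pj)))

3≤count : ∀ {n} (p : Fin n → Bool) {i j k} → i ≢ j → i ≢ k → j ≢ k →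
          T (p i) → T (p j) → T (p k) → 3 ≤ count p
3≤count {suc n} p {i} {j} {k} i≢j i≢k j≢k pi pj pk with p i | count-punchIn p i
... | true | eq = subst (3 ≤_) (sym eq) (s≤s (2≤count (p ∘ punchIn i)
      (j≢k ∘ punchOut-injective i≢j i≢k)
      (subst (T ∘ p) (sym (punchIn-punchOut i≢j)) pj)
      (subst (T ∘ p) (sym (punchIn-punchOut i≢k)) pk)))

count-split : ∀ {n} (p q : Fin n → Bool) →
              count p ≡ count (λ i → p i ∧ q i) + count (λ i → p i ∧ not (q i))
count-split p q = trans (sum-cong-≗ (λ i → split (p i) (q i)))
                        (∑-distrib-+ (λ i → iverson (p i ∧ q i)) (λ i → iverson (p i ∧ not (q i))))
  where
  split : ∀ b c → iverson b ≡ iverson (b ∧ c) + iverson (b ∧ not c)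
  split true true = refl
  split true false = refl
  split false c = refl

count-∨ : ∀ {n} (p q : Fin n → Bool) → (∀ i → T (p i) → ¬ T (q i)) →
          count p + count q ≡ count (λ i → p i ∨ q i)
count-∨ p q disjoint = trans (sym (∑-distrib-+ (iverson ∘ p) (iverson ∘ q)))
                             (sum-cong-≗ (λ i → join (p i) (q i) (disjoint i)))
  where
  join : ∀ b c → (T b → ¬ T c) → iverson b + iverson c ≡ iverson (b ∨ c)
  join true true disj = ⊥-elim (disj tt tt)
  join true false _ = refl
  join false c _ = refl

count-permute : ∀ {n} (p : Fin n → Bool) (π : Permutation′ n) → count (p ∘ (π ⟨$⟩ʳ_)) ≡ count p
count-permute p π = sym (sum-permute (iverson ∘ p) π)

∑-const : ∀ n k → sum {n} (λ _ → k) ≡ n * k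
∑-const zero k = refl
∑-const (suc n) k = cong (k +_) (∑-const n k)

record Enumeration {n} (p : Fin n → Bool) (m : ℕ) : Set where
  field
    elem           : Fin m → Fin n
    elem-injective : Injective _≡_ _≡_ elem
    elem-holds     : ∀ i → T (p (elem i))
    index          : ∀ {x} → T (p x) → Fin m
    elem-index     : ∀ {x} (px : T (p x)) → elem (index px) ≡ x

enumeration : ∀ {n} (p : Fin n → Bool) → Enumeration p (count p)
enumeration {zero} p = record
  { elem = λ () ; elem-injective = λ { {()} } ; elem-holds = λ ()
  ; index = λ { {()} } ; elem-index = λ { {()} } }
enumeration {suc n} p with p zero in p0
... | true = record
  { elem = λ { zero → zero ; (suc i) → suc (elem i) }
  ; elem-injective = λ { {zero} {zero} _ → refl
                       ; {suc i} {suc j} eq → cong suc (elem-injective (suc-injective eq)) }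
  ; elem-holds = λ { zero → subst T (sym p0) tt ; (suc i) → elem-holds i }
  ; index = λ { {zero} _ → zero ; {suc x} px → suc (index px) }
  ; elem-index = λ { {zero} _ → refl ; {suc x} px → cong suc (elem-index px) } }
  where open Enumeration (enumeration (p ∘ suc))
... | false = record
  { elem = suc ∘ elem
  ; elem-injective = elem-injective ∘ suc-injective
  ; elem-holds = elem-holds
  ; index = λ { {zero} p0′ → ⊥-elim (subst T p0 p0′) ; {suc x} px → index px }
  ; elem-index = λ { {zero} p0′ → ⊥-elim (subst T p0 p0′) ; {suc x} px → cong suc (elem-index px) } }
  where open Enumeration (enumeration (p ∘ suc))

open Enumeration

≤count⇒injection : ∀ {m n} (p : Fin n → Bool) → m ≤ count p →
                   Σ (Fin m → Fin n) λ f → Injective _≡_ _≡_ f × (∀ i → T (p (f i)))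
≤count⇒injection p m≤ =
  (λ i → elem E (inject≤ i m≤)) ,
  (λ eq → inject≤-injective m≤ m≤ _ _ (elem-injective E eq)) ,
  (λ i → elem-holds E (inject≤ i m≤))
  where E = enumeration p

injection⇒≤count : ∀ {m n} (p : Fin n → Bool) (f : Fin m → Fin n) → Injective _≡_ _≡_ f →
                   (∀ i → T (p (f i))) → m ≤ count p
injection⇒≤count p f f-injective holds = injective⇒≤ {f = index E ∘ holds} λ eq →
  f-injective (trans (sym (elem-index E _)) (trans (cong (elem E) eq) (elem-index E _)))
  where E = enumeration p

count≤count-along : ∀ {m n} {p : Fin n → Bool} (E : Enumeration p m) (q : Fin n → Bool) →
                    (∀ {x} → T (q x) → T (p x)) → count q ≤ count (q ∘ elem E)
count≤count-along E q q⊆p =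
  let f , f-injective , holds = ≤count⇒injection q ≤-refl
      g = λ i → index E (q⊆p (holds i))
  in injection⇒≤count (q ∘ elem E) g
       (λ eq → f-injective (trans (sym (elem-index E _)) (trans (cong (elem E) eq) (elem-index E _))))
       (λ i → subst (T ∘ q) (sym (elem-index E _)) (holds i))

restrict : ∀ {n m} {p : Fin n → Bool} (E : Enumeration p m) (σ : Permutation′ n) →
           (∀ x → p (σ ⟨$⟩ʳ x) ≡ p x) →
           Σ (Permutation′ m) λ π → ∀ i → elem E (π ⟨$⟩ʳ i) ≡ σ ⟨$⟩ʳ elem E i
restrict {m = m} {p} E σ invariant = permutation forth back forth-back back-forth , λ i → elem-index E _
  where
  invariant⁻¹ : ∀ x → p (σ ⟨$⟩ˡ x) ≡ p x
  invariant⁻¹ x = trans (sym (invariant (σ ⟨$⟩ˡ x))) (cong p (inverseʳ σ))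
  forth back : Fin m → Fin m
  forth i = index E (subst T (sym (invariant (elem E i))) (elem-holds E i))
  back i = index E (subst T (sym (invariant⁻¹ (elem E i))) (elem-holds E i))
  forth-back : ∀ i → forth (back i) ≡ i
  forth-back i = elem-injective E
    (trans (elem-index E _) (trans (cong (σ ⟨$⟩ʳ_) (elem-index E _)) (inverseʳ σ)))
  back-forth : ∀ i → back (forth i) ≡ i
  back-forth i = elem-injective E
    (trans (elem-index E _) (trans (cong (σ ⟨$⟩ˡ_) (elem-index E _)) (inverseˡ σ)))

length-filter-tabulate : ∀ {a} {A : Set a} {n} (p : A → Bool) (f : Fin n → A) →
                         length (filterᵇ p (tabulate f)) ≡ count (p ∘ f)
length-filter-tabulate {n = zero} p f = refl
length-filter-tabulate {n = suc n} p f with p (f zero)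
... | true = cong suc (length-filter-tabulate p (f ∘ suc))
... | false = length-filter-tabulate p (f ∘ suc)

-- Vertex-transitive digraphs on at most five vertices

degree-cases : ∀ {k m} → suc (k + k) ≤ m → m < 6 → k ≤ 1 ⊎ (k ≡ 2 × m ≡ 5)
degree-cases {0} _ _ = inj₁ z≤n
degree-cases {1} _ _ = inj₁ (s≤s z≤n)
degree-cases {2} 5≤m m<6 = inj₂ (refl , ≤-antisym (≤-pred m<6) 5≤m)
degree-cases {suc (suc (suc k))} 2k+1≤m m<6 =
  ⊥-elim (1+n≰n (≤-trans (≤-trans 6≤2k+1 2k+1≤m) (≤-pred m<6)))
  where
  6≤2k+1 : 6 ≤ suc (suc (suc (suc k)) + suc (suc (suc k)))
  6≤2k+1 = s≤s (s≤s (s≤s (s≤s (≤-trans (s≤s (s≤s z≤n)) (m≤n+m (suc (suc (suc k))) k)))))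

module _ (Δ : Digraph) where
  private
    V = Fin (n Δ)
    _⇒_ : V → V → Set
    x ⇒ y = T (adj Δ x y)

  ⇒-irrefl : ∀ {x} → ¬ x ⇒ x
  ⇒-irrefl {x} = subst T (irrefl Δ x)

  ⇒-asym : ∀ {x y} → x ⇒ y → ¬ y ⇒ x
  ⇒-asym {x} {y} x⇒y = subst T (antisym Δ x y x⇒y)

  outdeg indeg : V → ℕ
  outdeg x = count (adj Δ x)
  indeg x = count (λ y → adj Δ y x)

  Adjacent : V → V → Set
  Adjacent x y = x ⇒ y ⊎ y ⇒ x

  Clique : (V → Bool) → Set
  Clique R = ∀ {x y} → T (R x) → T (R y) → x ≢ y → Adjacent x y

  LocallyClique : Set
  LocallyClique = ∀ x → Clique (adj Δ x) × Clique (λ y → adj Δ y x)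

  Tournament : Set
  Tournament = ∀ {x y} → x ≢ y → Adjacent x y

  Regular : ℕ → Set
  Regular k = ∀ x → outdeg x ≡ k × indeg x ≡ k

  VertexTransitive : Set
  VertexTransitive = ∀ x y → ∃[ π ] IsAutomorphism Δ π × π ⟨$⟩ʳ x ≡ y

  automorphism-outdeg : ∀ π → IsAutomorphism Δ π → ∀ x → outdeg (π ⟨$⟩ʳ x) ≡ outdeg x
  automorphism-outdeg π aut x = trans (sym (count-permute (adj Δ (π ⟨$⟩ʳ x)) π)) (count-cong (aut x))

  automorphism-indeg : ∀ π → IsAutomorphism Δ π → ∀ x → indeg (π ⟨$⟩ʳ x) ≡ indeg x
  automorphism-indeg π aut x =
    trans (sym (count-permute (λ y → adj Δ y (π ⟨$⟩ʳ x)) π)) (count-cong (λ y → aut y x))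

  ∑outdeg≡∑indeg : sum outdeg ≡ sum indeg
  ∑outdeg≡∑indeg = ∑-comm (λ x y → iverson (adj Δ x y))

  vertex-transitive⇒regular : VertexTransitive → ∀ x₀ → Regular (outdeg x₀)
  vertex-transitive⇒regular vt x₀ x = outdeg-const x , trans (indeg-const x) (sym outdeg≡indeg)
    where
    outdeg-const : ∀ x → outdeg x ≡ outdeg x₀
    outdeg-const x with vt x₀ x
    ... | π , aut , refl = automorphism-outdeg π aut x₀
    indeg-const : ∀ x → indeg x ≡ indeg x₀
    indeg-const x with vt x₀ x
    ... | π , aut , refl = automorphism-indeg π aut x₀
    open ≡-Reasoning
    outdeg≡indeg : outdeg x₀ ≡ indeg x₀
    outdeg≡indeg = *-cancelˡ-≡ _ _ (n Δ) {{nonZeroIndex x₀}} (begin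
      n Δ * outdeg x₀              ≡⟨ ∑-const (n Δ) (outdeg x₀) ⟨
      sum {n Δ} (λ _ → outdeg x₀)  ≡⟨ sum-cong-≗ outdeg-const ⟨
      sum outdeg                   ≡⟨ ∑outdeg≡∑indeg ⟩
      sum indeg                    ≡⟨ sum-cong-≗ indeg-const ⟩
      sum {n Δ} (λ _ → indeg x₀)   ≡⟨ ∑-const (n Δ) (indeg x₀) ⟩
      n Δ * indeg x₀               ∎)

  regular⇒adjacent-count : ∀ {k} → Regular k → ∀ x → count (λ y → adj Δ x y ∨ adj Δ y x) ≡ k + k
  regular⇒adjacent-count {k} reg x = begin
    count (λ y → adj Δ x y ∨ adj Δ y x) ≡⟨ count-∨ (adj Δ x) (λ y → adj Δ y x) (λ y → ⇒-asym) ⟨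
    outdeg x + indeg x                   ≡⟨ cong₂ _+_ (proj₁ (reg x)) (proj₂ (reg x)) ⟩
    k + k                                ∎
    where open ≡-Reasoning

  ¬adjacent-self : ∀ x → ¬ T (adj Δ x x ∨ adj Δ x x)
  ¬adjacent-self x = subst (λ b → ¬ T (b ∨ b)) (sym (irrefl Δ x)) (λ ())

  regular⇒2k<n : ∀ {k} → Regular k → V → suc (k + k) ≤ n Δ
  regular⇒2k<n reg x = subst (λ d → suc d ≤ n Δ) (regular⇒adjacent-count reg x) (count<n _ (¬adjacent-self x))

  regular⇒tournament : ∀ {k} → Regular k → suc (k + k) ≡ n Δ → Tournament
  regular⇒tournament reg 2k+1≡n {x} x≢y = Equivalence.to T-∨
    (1+count≡n⇒all-but _ (¬adjacent-self x) (trans (cong suc (regular⇒adjacent-count reg x)) 2k+1≡n) x≢y)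

  count≤1⇒clique : ∀ {R} → count R ≤ 1 → Clique R
  count≤1⇒clique {R} small Rx Ry x≢y = ⊥-elim (1+n≰n (≤-trans (2≤count R x≢y Rx Ry) small))

  regular⇒locally-clique : ∀ {k} → Regular k → k ≤ 1 ⊎ (k ≡ 2 × n Δ ≡ 5) → LocallyClique
  regular⇒locally-clique reg (inj₁ k≤1) x =
    count≤1⇒clique (subst (_≤ 1) (sym (proj₁ (reg x))) k≤1) ,
    count≤1⇒clique (subst (_≤ 1) (sym (proj₂ (reg x))) k≤1)
  regular⇒locally-clique reg (inj₂ (refl , n≡5)) x = (λ _ _ → tournament) , (λ _ _ → tournament)
    where
    tournament : Tournament
    tournament = regular⇒tournament reg (sym n≡5)

  regular⇒successor : ∀ {k} → Regular k → 1 ≤ k → ∀ x → ∃[ y ] x ⇒ y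
  regular⇒successor reg 1≤k x =
    let f , _ , holds = ≤count⇒injection (adj Δ x) (subst (1 ≤_) (sym (proj₁ (reg x))) 1≤k)
    in f zero , holds zero

  invariant-small-clique⇒fixed : ∀ π → IsAutomorphism Δ π →
                                 (R : V → Bool) → (∀ x → R (π ⟨$⟩ʳ x) ≡ R x) → count R ≤ 2 → Clique R →
                                 ∀ {x} → T (R x) → π ⟨$⟩ʳ x ≡ x
  invariant-small-clique⇒fixed π aut R invariant small clique {x} Rx with π ⟨$⟩ʳ x ≟ x
  ... | yes fixed = fixed
  ... | no moved with π ⟨$⟩ʳ (π ⟨$⟩ʳ x) ≟ x
  ... | yes swapped = ⊥-elim ([ no-arc-to-image , no-arc-from-image ] (clique Rx Rπx (moved ∘ sym)))
    where
    Rπx : T (R (π ⟨$⟩ʳ x))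
    Rπx = subst T (sym (invariant x)) Rx
    π⇒ : ∀ {y z} → y ⇒ z → (π ⟨$⟩ʳ y) ⇒ (π ⟨$⟩ʳ z)
    π⇒ {y} {z} = subst T (sym (aut y z))
    no-arc-to-image : ¬ x ⇒ (π ⟨$⟩ʳ x)
    no-arc-to-image x⇒πx = ⇒-asym x⇒πx (subst ((π ⟨$⟩ʳ x) ⇒_) swapped (π⇒ x⇒πx))
    no-arc-from-image : ¬ (π ⟨$⟩ʳ x) ⇒ x
    no-arc-from-image πx⇒x = ⇒-asym πx⇒x (subst (_⇒ (π ⟨$⟩ʳ x)) swapped (π⇒ πx⇒x))
  ... | no ¬swapped = ⊥-elim (1+n≰n (≤-trans orbit≥3 small))
    where
    Rπx : T (R (π ⟨$⟩ʳ x))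
    Rπx = subst T (sym (invariant x)) Rx
    orbit≥3 : 3 ≤ count R
    orbit≥3 = 3≤count R (moved ∘ sym) (¬swapped ∘ sym) (moved ∘ sym ∘ Injection.injective (↔⇒↣ π))
                      Rx Rπx (subst T (sym (invariant (π ⟨$⟩ʳ x))) Rπx)

  out-closed⇒3≤count : (∀ x → ∃[ y ] x ⇒ y) → (S : V → Bool) →
                       (∀ {x y} → T (S x) → x ⇒ y → T (S y)) → ∀ {x} → T (S x) → 3 ≤ count S
  out-closed⇒3≤count successor S closed {x} Sx =
    3≤count S (λ x≡y → ⇒-irrefl (subst (x ⇒_) (sym x≡y) x⇒y))
              (λ x≡z → ⇒-asym x⇒y (subst (y ⇒_) (sym x≡z) y⇒z))
              (λ y≡z → ⇒-irrefl (subst (y ⇒_) (sym y≡z) y⇒z))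
              Sx Sy (closed Sy y⇒z)
    where
    y = proj₁ (successor x)
    x⇒y = proj₂ (successor x)
    z = proj₁ (successor y)
    y⇒z = proj₂ (successor y)
    Sy = closed Sx x⇒y

  module _ {k} (reg : Regular k) (k≤2 : k ≤ 2) (cliques : LocallyClique)
           (π : Permutation′ (n Δ)) (aut : IsAutomorphism Δ π) where

    out-neighbour-fixed : ∀ {x y} → π ⟨$⟩ʳ x ≡ x → x ⇒ y → π ⟨$⟩ʳ y ≡ y
    out-neighbour-fixed {x} πx≡x =
      invariant-small-clique⇒fixed π aut (adj Δ x)
        (λ y → trans (cong (λ z → adj Δ z (π ⟨$⟩ʳ y)) (sym πx≡x)) (aut x y))
        (subst (_≤ 2) (sym (proj₁ (reg x))) k≤2) (proj₁ (cliques x))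

    in-neighbour-fixed : ∀ {x y} → π ⟨$⟩ʳ y ≡ y → x ⇒ y → π ⟨$⟩ʳ x ≡ x
    in-neighbour-fixed {y = y} πy≡y =
      invariant-small-clique⇒fixed π aut (λ x → adj Δ x y)
        (λ x → trans (cong (adj Δ (π ⟨$⟩ʳ x)) (sym πy≡y)) (aut x y))
        (subst (_≤ 2) (sym (proj₂ (reg y))) k≤2) (proj₂ (cliques y))

    Fixed : V → Bool
    Fixed x = isYes (π ⟨$⟩ʳ x ≟ x)

    fixed-out-closed : ∀ {x y} → T (Fixed x) → x ⇒ y → T (Fixed y)
    fixed-out-closed Fx x⇒y = fromWitness (out-neighbour-fixed (toWitness Fx) x⇒y)

    moved-out-closed : ∀ {x y} → T (not (Fixed x)) → x ⇒ y → T (not (Fixed y))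
    moved-out-closed Mx x⇒y = fromWitnessFalse (toWitnessFalse Mx ∘ λ πy≡y → in-neighbour-fixed πy≡y x⇒y)

    fixing-a-vertex⇒identity : (∀ x → ∃[ y ] x ⇒ y) → n Δ < 6 →
                                ∀ {x} → π ⟨$⟩ʳ x ≡ x → ∀ y → π ⟨$⟩ʳ y ≡ y
    fixing-a-vertex⇒identity successor n<6 {x} πx≡x y with π ⟨$⟩ʳ y ≟ y
    ... | yes πy≡y = πy≡y
    ... | no πy≢y = ⊥-elim (1+n≰n (begin
      6                                  ≤⟨ +-mono-≤ fixed≥3 moved≥3 ⟩
      count Fixed + count (not ∘ Fixed)  ≡⟨ count-split (λ _ → true) Fixed ⟨
      count {n Δ} (λ _ → true)           ≤⟨ count≤n _ ⟩
      n Δ                                ≤⟨ ≤-pred n<6 ⟩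
      5                                  ∎))
      where
      open ≤-Reasoning
      fixed≥3 : 3 ≤ count Fixed
      fixed≥3 = out-closed⇒3≤count successor Fixed fixed-out-closed (fromWitness πx≡x)
      moved≥3 : 3 ≤ count (not ∘ Fixed)
      moved≥3 = out-closed⇒3≤count successor (not ∘ Fixed) moved-out-closed (fromWitnessFalse πy≢y)

  vertex-transitive⇒outdeg≤2 : VertexTransitive → n Δ < 6 → ∀ x → outdeg x ≤ 2
  vertex-transitive⇒outdeg≤2 vt n<6 x with degree-cases (regular⇒2k<n (vertex-transitive⇒regular vt x) x) n<6
  ... | inj₁ k≤1 = m≤n⇒m≤1+n k≤1
  ... | inj₂ (k≡2 , _) = ≤-reflexive k≡2

  vertex-transitive⇒stabiliser-trivial : VertexTransitive → n Δ < 6 → ∀ {x₀ y₀} → x₀ ⇒ y₀ →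
    ∀ π → IsAutomorphism Δ π → ∀ {x} → π ⟨$⟩ʳ x ≡ x → ∀ y → π ⟨$⟩ʳ y ≡ y
  vertex-transitive⇒stabiliser-trivial vt n<6 {x₀} x₀⇒y₀ π aut =
    fixing-a-vertex⇒identity reg (vertex-transitive⇒outdeg≤2 vt n<6 x₀)
      (regular⇒locally-clique reg (degree-cases (regular⇒2k<n reg x₀) n<6)) π aut
      (regular⇒successor reg (1≤count (adj Δ x₀) x₀⇒y₀)) n<6
    where
    reg = vertex-transitive⇒regular vt x₀

-- Geodesic-transitive digraphs

module _ (Γ : Digraph) where
  private
    V = Fin (n Γ)
    _⇒_ : V → V → Set
    x ⇒ y = T (adj Γ x y)

  arc⇒geodesic : ∀ {x y} → x ⇒ y → IsGeodesic Γ (x ∷ y ∷ [])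
  arc⇒geodesic x⇒y = (x⇒y , tt) , step x⇒y here ,
    λ { zero _ here → ⇒-irrefl Γ x⇒y ; (suc _) (s≤s ()) _ }

  2-arc⇒geodesic : ∀ {x y z} → x ⇒ y → y ⇒ z → ¬ x ⇒ z → IsGeodesic Γ (x ∷ y ∷ z ∷ [])
  2-arc⇒geodesic x⇒y y⇒z ¬x⇒z = (x⇒y , y⇒z , tt) , step x⇒y (step y⇒z here) ,
    λ { zero _ here → ⇒-asym Γ x⇒y y⇒z
      ; (suc zero) _ (step x⇒z here) → ¬x⇒z x⇒z
      ; (suc (suc _)) (s≤s (s≤s ())) _ }

  outDeg≡count : ∀ u → outDeg Γ u ≡ count (adj Γ u)
  outDeg≡count u = length-filter-tabulate (adj Γ u) id

  out-enumeration : ∀ {d u} → outDeg Γ u ≡ d → Enumeration (adj Γ u) d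
  out-enumeration {u = u} deg =
    subst (Enumeration (adj Γ u)) (trans (sym (outDeg≡count u)) deg) (enumeration (adj Γ u))

  induced : ∀ {m} {p : V → Bool} → Enumeration p m → Digraph
  induced {m} E = record
    { n = m
    ; adj = λ i j → adj Γ (elem E i) (elem E j)
    ; irrefl = λ i → irrefl Γ (elem E i)
    ; antisym = λ i j → antisym Γ (elem E i) (elem E j) }

module _ (Γ : Digraph) (G : AutSubgroup Γ) (gt : GeodesicTransitive Γ G 2) where
  private
    V = Fin (n Γ)
    _⇒_ : V → V → Set
    x ⇒ y = T (adj Γ x y)

  preserves-⇒ : ∀ {σ} → mem G σ → ∀ {x y} → x ⇒ y → (σ ⟨$⟩ʳ x) ⇒ (σ ⟨$⟩ʳ y)
  preserves-⇒ σ∈G {x} {y} = subst T (sym (isAut G σ∈G x y))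

  arc-transitive : ∀ {x y x′ y′} → x ⇒ y → x′ ⇒ y′ →
                   ∃[ σ ] mem G σ × σ ⟨$⟩ʳ x ≡ x′ × σ ⟨$⟩ʳ y ≡ y′
  arc-transitive x⇒y x′⇒y′ with gt 1 (s≤s z≤n) _ _ (arc⇒geodesic Γ x⇒y) (arc⇒geodesic Γ x′⇒y′)
  ... | σ , σ∈G , refl = σ , σ∈G , refl , refl

  2-geodesic-transitive : ∀ {x y z x′ y′ z′} → x ⇒ y → y ⇒ z → ¬ x ⇒ z →
                          x′ ⇒ y′ → y′ ⇒ z′ → ¬ x′ ⇒ z′ →
                          ∃[ σ ] mem G σ × σ ⟨$⟩ʳ x ≡ x′ × σ ⟨$⟩ʳ y ≡ y′ × σ ⟨$⟩ʳ z ≡ z′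
  2-geodesic-transitive x⇒y y⇒z ¬x⇒z x′⇒y′ y′⇒z′ ¬x′⇒z′
    with gt 2 ≤-refl _ _ (2-arc⇒geodesic Γ x⇒y y⇒z ¬x⇒z)
                         (2-arc⇒geodesic Γ x′⇒y′ y′⇒z′ ¬x′⇒z′)
  ... | σ , σ∈G , refl = σ , σ∈G , refl , refl , refl

  transitive-triangle-shift : ∀ {a b c} → a ⇒ b → b ⇒ c → a ⇒ c → ∃[ d ] c ⇒ d × b ⇒ d
  transitive-triangle-shift {c = c} a⇒b b⇒c a⇒c with arc-transitive a⇒b b⇒c
  ... | τ , τ∈G , τa≡b , τb≡c =
    τ ⟨$⟩ʳ c , subst (_⇒ (τ ⟨$⟩ʳ c)) τb≡c (preserves-⇒ τ∈G b⇒c)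
             , subst (_⇒ (τ ⟨$⟩ʳ c)) τa≡b (preserves-⇒ τ∈G a⇒c)

  module _ {d} (valency : ∀ u → outDeg Γ u ≡ d) (4≤d : 4 ≤ d) (d<6 : d < 6) where

    Γ⁺ : ∀ u → Enumeration (adj Γ u) d
    Γ⁺ u = out-enumeration Γ (valency u)

    [Γ⁺] : V → Digraph
    [Γ⁺] u = induced Γ (Γ⁺ u)

    stabiliser⇒local-automorphism : ∀ {u σ} → mem G σ → σ ⟨$⟩ʳ u ≡ u →
      Σ (Permutation′ d) λ π → IsAutomorphism ([Γ⁺] u) π ×
                               ∀ i → elem (Γ⁺ u) (π ⟨$⟩ʳ i) ≡ σ ⟨$⟩ʳ elem (Γ⁺ u) i
    stabiliser⇒local-automorphism {u} {σ} σ∈G σu≡u =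
      let π , commutes = restrict (Γ⁺ u) σ fixes-Γ⁺
      in π , (λ i j → trans (cong₂ (adj Γ) (commutes i) (commutes j)) (isAut G σ∈G _ _)) , commutes
      where
      fixes-Γ⁺ : ∀ x → adj Γ u (σ ⟨$⟩ʳ x) ≡ adj Γ u x
      fixes-Γ⁺ x = trans (cong (λ v → adj Γ v (σ ⟨$⟩ʳ x)) (sym σu≡u)) (isAut G σ∈G u x)

    local-vertex-transitive : ∀ u → VertexTransitive ([Γ⁺] u)
    local-vertex-transitive u i j with arc-transitive (elem-holds (Γ⁺ u) i) (elem-holds (Γ⁺ u) j)
    ... | σ , σ∈G , σu≡u , σi≡j with stabiliser⇒local-automorphism σ∈G σu≡u
    ... | π , aut , commutes = π , aut , elem-injective (Γ⁺ u) (trans (commutes i) σi≡j)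

    triangle-stabiliser-fixes-out-neighbours : ∀ {u v w σ} → u ⇒ v → v ⇒ w → u ⇒ w →
      mem G σ → σ ⟨$⟩ʳ u ≡ u → σ ⟨$⟩ʳ v ≡ v → ∀ {y} → u ⇒ y → σ ⟨$⟩ʳ y ≡ y
    triangle-stabiliser-fixes-out-neighbours {u} {v} {w} {σ} u⇒v v⇒w u⇒w σ∈G σu≡u σv≡v {y} u⇒y
      with stabiliser⇒local-automorphism σ∈G σu≡u
    ... | π , aut , commutes = begin
      σ ⟨$⟩ʳ y                      ≡⟨ cong (σ ⟨$⟩ʳ_) (elem-index E u⇒y) ⟨
      σ ⟨$⟩ʳ elem E (index E u⇒y)   ≡⟨ commutes _ ⟨
      elem E (π ⟨$⟩ʳ index E u⇒y)   ≡⟨ cong (elem E) (π-trivial (index E u⇒y)) ⟩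
      elem E (index E u⇒y)          ≡⟨ elem-index E u⇒y ⟩
      y                             ∎
      where
      open ≡-Reasoning
      E = Γ⁺ u
      local-arc : T (adj ([Γ⁺] u) (index E u⇒v) (index E u⇒w))
      local-arc = subst T (sym (cong₂ (adj Γ) (elem-index E u⇒v) (elem-index E u⇒w))) v⇒w
      π-fixes-v : π ⟨$⟩ʳ index E u⇒v ≡ index E u⇒v
      π-fixes-v = elem-injective E (begin
        elem E (π ⟨$⟩ʳ index E u⇒v)   ≡⟨ commutes _ ⟩
        σ ⟨$⟩ʳ elem E (index E u⇒v)   ≡⟨ cong (σ ⟨$⟩ʳ_) (elem-index E u⇒v) ⟩
        σ ⟨$⟩ʳ v                      ≡⟨ σv≡v ⟩
        v                             ≡⟨ elem-index E u⇒v ⟨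
        elem E (index E u⇒v)          ∎)
      π-trivial : ∀ i → π ⟨$⟩ʳ i ≡ i
      π-trivial = vertex-transitive⇒stabiliser-trivial ([Γ⁺] u) (local-vertex-transitive u) d<6
                    local-arc π aut π-fixes-v

    Common : V → V → V → Bool
    Common u v w = adj Γ v w ∧ adj Γ u w

    common-out-neighbours≤2 : ∀ {u v} → u ⇒ v → count (Common u v) ≤ 2
    common-out-neighbours≤2 {u} {v} u⇒v = begin
      count (Common u v)                ≤⟨ count≤count-along E (Common u v) (proj₂ ∘ Equivalence.to T-∧) ⟩
      count (Common u v ∘ elem E)       ≤⟨ count-mono _ (adj Γ v ∘ elem E) (λ i → proj₁ ∘ Equivalence.to T-∧) ⟩
      count (adj Γ v ∘ elem E)          ≡⟨ count-cong (λ i → cong (λ x → adj Γ x (elem E i)) (elem-index E u⇒v)) ⟨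
      outdeg ([Γ⁺] u) (index E u⇒v)     ≤⟨ vertex-transitive⇒outdeg≤2 ([Γ⁺] u) (local-vertex-transitive u) d<6 _ ⟩
      2                                 ∎
      where
      open ≤-Reasoning
      E = Γ⁺ u

    two-private-out-neighbours : ∀ {u v} → u ⇒ v →
      ∃₂ λ w w′ → w ≢ w′ × (v ⇒ w × ¬ u ⇒ w) × (v ⇒ w′ × ¬ u ⇒ w′)
    two-private-out-neighbours {u} {v} u⇒v =
      let f , f-injective , is-private = ≤count⇒injection Private two
      in f zero , f (suc zero) , 0≢1+n ∘ f-injective ,
         unpack (is-private zero) , unpack (is-private (suc zero))
      where
      Private : V → Bool
      Private w = adj Γ v w ∧ not (adj Γ u w)
      open ≤-Reasoning
      two : 2 ≤ count Private
      two = +-cancelˡ-≤ 2 2 (count Private) (begin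
        4                                  ≤⟨ 4≤d ⟩
        d                                  ≡⟨ trans (sym (valency v)) (outDeg≡count Γ v) ⟩
        count (adj Γ v)                    ≡⟨ count-split (adj Γ v) (adj Γ u) ⟩
        count (Common u v) + count Private ≤⟨ +-monoˡ-≤ (count Private) (common-out-neighbours≤2 u⇒v) ⟩
        2 + count Private                  ∎)
      unpack : ∀ {w} → T (Private w) → v ⇒ w × ¬ u ⇒ w
      unpack p = proj₁ (Equivalence.to T-∧ p) ,
                 subst T (Equivalence.to T-not-≡ (proj₂ (Equivalence.to T-∧ p)))

    no-transitive-triangle : ∀ {a b c} → a ⇒ b → b ⇒ c → a ⇒ c → ⊥
    no-transitive-triangle a⇒b b⇒c a⇒c =
      let w , w′ , w≢w′ , (b⇒w , ¬a⇒w) , (b⇒w′ , ¬a⇒w′) = two-private-out-neighbours a⇒b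
          σ , σ∈G , σa≡a , σb≡b , σw≡w′ = 2-geodesic-transitive a⇒b b⇒w ¬a⇒w a⇒b b⇒w′ ¬a⇒w′
          e , c⇒e , b⇒e = transitive-triangle-shift a⇒b b⇒c a⇒c
          σc≡c = triangle-stabiliser-fixes-out-neighbours a⇒b b⇒c a⇒c σ∈G σa≡a σb≡b a⇒c
          σw≡w = triangle-stabiliser-fixes-out-neighbours b⇒c c⇒e b⇒e σ∈G σb≡b σc≡c b⇒w
      in w≢w′ (trans (sym σw≡w) σw≡w′)

    2-arc-transitive : ArcTransitive Γ G 2
    2-arc-transitive (x ∷ y ∷ z ∷ []) (x′ ∷ y′ ∷ z′ ∷ []) (x⇒y , y⇒z , _) (x′⇒y′ , y′⇒z′ , _) =
      gt 2 ≤-refl _ _ (2-arc⇒geodesic Γ x⇒y y⇒z (no-transitive-triangle x⇒y y⇒z))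
                      (2-arc⇒geodesic Γ x′⇒y′ y′⇒z′ (no-transitive-triangle x′⇒y′ y′⇒z′))

lemma4p9 : (Γ : Digraph) (G : AutSubgroup Γ) →
    (∀ (v : Fin (n Γ)) → outDeg Γ v ≡ 5) →
    GeodesicTransitive Γ G 2 →
    ArcTransitive Γ G 2
lemma4p9 Γ G valency gt = 2-arc-transitive Γ G gt valency (n≤1+n 4) ≤-refl
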